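{- Let $p$ be an odd prime and let $a_1, a_2, \dots, a_n$ be positive integers with $T:=\sum_{i=1}^{n} a_i \leq 2(p-1)$. Then \[ \sum_{j=0}^{p-1}\left[ \prod_{i=1}^{n} (j+1)_{a_i}\right] \left[1+j\sum_{i=1}^{n} \left( H_{a_i+j}^{(1)} - H_{j}^{(1)}\right)\right] \equiv \begin{cases} 0 & \text{if } T< 2(p-1),\\ 1 & \text{if } T=2(p-1), \end{cases} \pmod{p}. \]
   Context: $(a)_0:=1$ and $(a)_k:=a(a+1)\cdots(a+k-1)$ for $k>0$. For positive integers $i,n$, $H^{(i)}_n:=\sum_{j=1}^n j^{ -i}$, and $H^{(i)}_0:=0$. -}

module Defs where

open import Data.Nat as ℕ using (ℕ; zero; suc; NonZero)
open import Data.Nat.Divisibility using (_∣_)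
open import Data.Integer as ℤ using (ℤ; +_)
open import Data.Rational using (ℚ; 0ℚ; 1ℚ; _+_; _-_; _*_; _/_)
open import Data.Fin using (Fin)
open import Data.Product using (Σ; ∃-syntax; _×_)
open import Relation.Nullary using (¬_)
open import Relation.Binary.PropositionalEquality using (_≡_)

poch : ℕ → ℕ → ℕ
poch a zero    = 1
poch a (suc k) = poch a k ℕ.* (a ℕ.+ k)

H : ℕ → ℚ
H zero    = 0ℚ
H (suc n) = H n + ((+ 1) / suc n)

ι : ℕ → ℚ
ι n = (+ n) / 1

sumTo : ℕ → (ℕ → ℚ) → ℚ
sumTo zero    f = 0ℚ
sumTo (suc m) f = sumTo m f + f m

sumFinℕ : ∀ n → (Fin n → ℕ) → ℕ
sumFinℕ zero    f = 0
sumFinℕ (suc n) f = f Data.Fin.zero ℕ.+ sumFinℕ n (λ i → f (Data.Fin.suc i))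

sumFin : ∀ n → (Fin n → ℚ) → ℚ
sumFin zero    f = 0ℚ
sumFin (suc n) f = f Data.Fin.zero + sumFin n (λ i → f (Data.Fin.suc i))

prodFinℕ : ∀ n → (Fin n → ℕ) → ℕ
prodFinℕ zero    f = 1
prodFinℕ (suc n) f = f Data.Fin.zero ℕ.* prodFinℕ n (λ i → f (Data.Fin.suc i))

-- congruence of p-integral rationals modulo p:
-- x ≡ y (mod p) iff x - y = p·c/d with c ∈ ℤ, d ∈ ℕ, p ∤ d
_≡_[modℚ_] : ℚ → ℚ → ℕ → Set
x ≡ y [modℚ p ] =
  ∃[ c ] ∃[ d ] Σ (NonZero d) λ nz →
    (¬ (p ∣ d)) × (x - y ≡ _/_ ((+ p) ℤ.* c) d {{nz}})

S : ℕ → ∀ n → (Fin n → ℕ) → ℚ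
S p n a = sumTo p λ j →
  ι (prodFinℕ n (λ i → poch (suc j) (a i)))
  * (1ℚ + ι j * sumFin n (λ i → H (a i ℕ.+ j) - H j))

module Submission where

-- Lemma 3.15. Let F_a(x) = ∏ᵢ (x + 1)_{aᵢ}, a monic polynomial with natural coefficients of degree
-- T = Σᵢ aᵢ. Its logarithmic derivative is Σᵢ (H_{aᵢ+x} - H_x), so the j-th summand of S is
-- F_a(j) + j·F_a′(j) = (x·F_a)′(j) and S = Σ_{j<p} (x·F_a)′(j) is a natural number (HarmonicBridge).
-- Writing F_a = Σ_{m<T} g_m x^m + x^T, this sum is Σ_m g_m·(m+1)·P_m + (T+1)·P_T with power sums
-- P_m = Σ_{j<p} j^m (PowerSums). Modulo p (PrimePowerSums): P_m ≡ 0 for m < p - 1, by strong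
-- induction on the telescoping identity Σ_j ((j+1)^{m+1} - j^{m+1}) = p^{m+1}; (m+1)·P_m = p·P_m for
-- m = p - 1; and for p - 1 < m < 2(p - 1) Fermat's little theorem (from p ∣ C(p, i)) gives
-- P_m ≡ P_{m-(p-1)} ≡ 0. Hence only the leading term survives: it is ≡ 0 when T < 2(p - 1), and for
-- T = 2(p - 1) it is (2p - 1)·P_{2(p-1)} ≡ (-1)·P_{p-1} ≡ (-1)·(-1) = 1.
-- Polynomials are coefficient lists (MonicPolynomials, BinomialPolynomials); congruences of natural
-- numbers are written x = y + p·s (NatArithmetic) and are transported to ℚ only at the end.

open import Data.Nat using (ℕ; suc)
open import Data.Nat.Primality using (Prime)

module NatArithmetic where
  open import Data.Nat
  open import Data.Nat.Properties
  open import Data.Nat.Divisibility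
  open import Data.Nat.Primality using (Prime; euclidsLemma)
  open import Data.Nat.Tactic.RingSolver using (solve-∀)
  open import Data.Sum using (inj₁; inj₂)
  open import Relation.Nullary using (¬_; contradiction)
  open import Relation.Binary.PropositionalEquality

  Σ< : ℕ → (ℕ → ℕ) → ℕ
  Σ< zero    f = 0
  Σ< (suc n) f = Σ< n f + f n

  Σ<-cong : ∀ n {f g} → (∀ j → f j ≡ g j) → Σ< n f ≡ Σ< n g
  Σ<-cong zero    f≡g = refl
  Σ<-cong (suc n) f≡g = cong₂ _+_ (Σ<-cong n f≡g) (f≡g n)

  Σ<-+ : ∀ n f g → Σ< n (λ j → f j + g j) ≡ Σ< n f + Σ< n g
  Σ<-+ zero    f g = refl
  Σ<-+ (suc n) f g = trans (cong (_+ (f n + g n)) (Σ<-+ n f g)) (swap (Σ< n f) (Σ< n g) (f n) (g n))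
    where swap : ∀ a b c d → a + b + (c + d) ≡ a + c + (b + d)
          swap = solve-∀

  Σ<-* : ∀ n c f → Σ< n (λ j → c * f j) ≡ c * Σ< n f
  Σ<-* zero    c f = sym (*-zeroʳ c)
  Σ<-* (suc n) c f = trans (cong (_+ c * f n) (Σ<-* n c f)) (sym (*-distribˡ-+ c (Σ< n f) (f n)))

  Σ<-ones : ∀ n → Σ< n (λ _ → 1) ≡ n
  Σ<-ones zero    = refl
  Σ<-ones (suc n) = trans (cong (_+ 1) (Σ<-ones n)) (+-comm n 1)

  Σ<-first : ∀ n f → Σ< (suc n) f ≡ f 0 + Σ< n (λ j → f (suc j))
  Σ<-first zero    f = +-comm 0 (f 0)
  Σ<-first (suc n) f = trans (cong (_+ f (suc n)) (Σ<-first n f)) (+-assoc (f 0) _ _)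

  -- x ≡⁺ y [mod p ]: x ≡ y (mod p) with x ≥ y, witnessed by x = y + p·s.
  infix 4 _≡⁺_[mod_]
  record _≡⁺_[mod_] (x y p : ℕ) : Set where
    constructor congruent
    field
      multiple : ℕ
      excess   : x ≡ y + p * multiple

  module _ {p : ℕ} where

    ≡⁺-reflexive : ∀ {x y} → x ≡ y → x ≡⁺ y [mod p ]
    ≡⁺-reflexive {x} {y} x≡y = congruent 0 (trans x≡y (sym (trans (cong (y +_) (*-zeroʳ p)) (+-identityʳ y))))

    ≡⁺-trans : ∀ {x y z} → x ≡⁺ y [mod p ] → y ≡⁺ z [mod p ] → x ≡⁺ z [mod p ]
    ≡⁺-trans {z = z} (congruent s x≡y+ps) (congruent t y≡z+pt) =
      congruent (t + s) (trans x≡y+ps (trans (cong (_+ p * s) y≡z+pt) (regroup z p t s)))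
      where regroup : ∀ z p t s → z + p * t + p * s ≡ z + p * (t + s)
            regroup = solve-∀

    ≡⁺-+ : ∀ {x y u v} → x ≡⁺ y [mod p ] → u ≡⁺ v [mod p ] → x + u ≡⁺ y + v [mod p ]
    ≡⁺-+ {y = y} {v = v} (congruent s x≡y+ps) (congruent t u≡v+pt) =
      congruent (s + t) (trans (cong₂ _+_ x≡y+ps u≡v+pt) (regroup y v p s t))
      where regroup : ∀ y v p s t → y + p * s + (v + p * t) ≡ y + v + p * (s + t)
            regroup = solve-∀

    ≡⁺-*ˡ : ∀ c {x y} → x ≡⁺ y [mod p ] → c * x ≡⁺ c * y [mod p ]
    ≡⁺-*ˡ c {y = y} (congruent s x≡y+ps) = congruent (c * s) (trans (cong (c *_) x≡y+ps) (regroup c y p s))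
      where regroup : ∀ c y p s → c * (y + p * s) ≡ c * y + p * (c * s)
            regroup = solve-∀

    Σ<-≡⁺ : ∀ n {f g} → (∀ j → j < n → f j ≡⁺ g j [mod p ]) → Σ< n f ≡⁺ Σ< n g [mod p ]
    Σ<-≡⁺ zero    f≡g = ≡⁺-reflexive refl
    Σ<-≡⁺ (suc n) f≡g = ≡⁺-+ (Σ<-≡⁺ n (λ j j<n → f≡g j (m<n⇒m<1+n j<n))) (f≡g n ≤-refl)

    ∣⇒≡⁺0 : ∀ {x} → p ∣ x → x ≡⁺ 0 [mod p ]
    ∣⇒≡⁺0 (divides s x≡sp) = congruent s (trans x≡sp (*-comm s p))

    ≡⁺-∣ : ∀ {x y} → x ≡⁺ y [mod p ] → p ∣ y → p ∣ x
    ≡⁺-∣ (congruent s x≡y+ps) p∣y = subst (p ∣_) (sym x≡y+ps) (∣m∣n⇒∣m+n p∣y (m∣m*n s))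

    prime-cancelˡ : Prime p → ∀ {k x} → ¬ p ∣ k → p ∣ k * x → p ∣ x
    prime-cancelˡ isPrime {k} {x} p∤k p∣kx with euclidsLemma k x isPrime p∣kx
    ... | inj₁ p∣k = contradiction p∣k p∤k
    ... | inj₂ p∣x = p∣x

    ≡⁺-cancelˡ : Prime p → ∀ {k x y} → ¬ p ∣ k → k * x ≡⁺ k * y [mod p ] → x ≡⁺ y [mod p ]
    ≡⁺-cancelˡ isPrime {k} {x} {y} p∤k (congruent s kx≡ky+ps) = congruent (_∣_.quotient p∣x∸y) x≡y+pt
      where
        instance
          k≢0 : NonZero k
          k≢0 = ≢-nonZero λ k≡0 → p∤k (subst (p ∣_) (sym k≡0) (p ∣0))
        y≤x : y ≤ x
        y≤x = *-cancelˡ-≤ k (subst (k * y ≤_) (sym kx≡ky+ps) (m≤m+n (k * y) (p * s)))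
        k[x∸y]≡ps : k * (x ∸ y) ≡ p * s
        k[x∸y]≡ps = trans (*-distribˡ-∸ k x y) (trans (cong (_∸ k * y) kx≡ky+ps) (m+n∸m≡n (k * y) (p * s)))
        p∣x∸y : p ∣ x ∸ y
        p∣x∸y = prime-cancelˡ isPrime p∤k (divides s (trans k[x∸y]≡ps (*-comm p s)))
        x≡y+pt : x ≡ y + p * _∣_.quotient p∣x∸y
        x≡y+pt = trans (sym (m+[n∸m]≡n y≤x)) (cong (y +_) (trans (_∣_.equality p∣x∸y) (*-comm _ p)))

module MonicPolynomials where
  open import Data.Nat
  open import Data.Nat.Properties
  open import Data.Nat.Tactic.RingSolver using (solve-∀)
  open import Data.List using (List; []; _∷_; length)
  import Data.Fin as Fin
  open import Relation.Binary.PropositionalEquality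
  open ≡-Reasoning
  open import Defs using (poch; prodFinℕ; sumFinℕ)

  -- A list G = [g₀, …, g_{d-1}] represents the monic polynomial
  -- M_G(x) = g₀ + g₁x + … + g_{d-1}x^{d-1} + x^d, so that M_{g ∷ G}(x) = g + x·M_G(x).
  monicAt : List ℕ → ℕ → ℕ
  monicAt []      x = 1
  monicAt (g ∷ G) x = g + x * monicAt G x

  -- x·M_G′(x), by differentiating M_{g ∷ G}(x) = g + x·M_G(x).
  xDerivAt : List ℕ → ℕ → ℕ
  xDerivAt []      x = 0
  xDerivAt (g ∷ G) x = x * (monicAt G x + xDerivAt G x)

  lowerAt : List ℕ → ℕ → ℕ
  lowerAt []      x = 0
  lowerAt (g ∷ G) x = g + x * lowerAt G x

  monicAt-lowerAt : ∀ G x → monicAt G x ≡ lowerAt G x + x ^ length G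
  monicAt-lowerAt []      x = refl
  monicAt-lowerAt (g ∷ G) x = trans (cong (λ v → g + x * v) (monicAt-lowerAt G x)) (expand g x (lowerAt G x) (x ^ length G))
    where expand : ∀ g x L X → g + x * (L + X) ≡ g + x * L + x * X
          expand = solve-∀

  plusTimesLinear : ℕ → ℕ → List ℕ → List ℕ
  plusTimesLinear c r []      = c + r ∷ []
  plusTimesLinear c r (g ∷ G) = c + r * g ∷ plusTimesLinear g r G

  length-plusTimesLinear : ∀ c r G → length (plusTimesLinear c r G) ≡ suc (length G)
  length-plusTimesLinear c r []      = refl
  length-plusTimesLinear c r (g ∷ G) = cong suc (length-plusTimesLinear g r G)

  monicAt-plusTimesLinear : ∀ c r G x → monicAt (plusTimesLinear c r G) x ≡ c + (x + r) * monicAt G x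
  monicAt-plusTimesLinear c r []      x = constant c r x
    where constant : ∀ c r x → c + r + x * 1 ≡ c + (x + r) * 1
          constant = solve-∀
  monicAt-plusTimesLinear c r (g ∷ G) x =
    trans (cong (λ v → c + r * g + x * v) (monicAt-plusTimesLinear g r G x)) (step c r g x (monicAt G x))
    where step : ∀ c r g x M → c + r * g + x * (g + (x + r) * M) ≡ c + (x + r) * (g + x * M)
          step = solve-∀

  xDerivAt-plusTimesLinear : ∀ c r G x →
    xDerivAt (plusTimesLinear c r G) x ≡ x * monicAt G x + (x + r) * xDerivAt G x
  xDerivAt-plusTimesLinear c r []      x = constant r x
    where constant : ∀ r x → x * (1 + 0) ≡ x * 1 + (x + r) * 0
          constant = solve-∀
  xDerivAt-plusTimesLinear c r (g ∷ G) x =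
    begin
      x * (monicAt (plusTimesLinear g r G) x + xDerivAt (plusTimesLinear g r G) x)
    ≡⟨ cong₂ (λ u v → x * (u + v)) (monicAt-plusTimesLinear g r G x) (xDerivAt-plusTimesLinear g r G x) ⟩
      x * ((g + (x + r) * monicAt G x) + (x * monicAt G x + (x + r) * xDerivAt G x))
    ≡⟨ step r g x (monicAt G x) (xDerivAt G x) ⟩
      x * (g + x * monicAt G x) + (x + r) * (x * (monicAt G x + xDerivAt G x))
    ∎
    where step : ∀ r g x M D → x * ((g + (x + r) * M) + (x * M + (x + r) * D))
                                ≡ x * (g + x * M) + (x + r) * (x * (M + D))
          step = solve-∀

  -- Derivative of the rising factorial (a)_k with respect to a, by the product rule.
  poch′ : ℕ → ℕ → ℕ
  poch′ a zero    = 0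
  poch′ a (suc k) = poch′ a k * (a + k) + poch a k

  timesPoch : ℕ → List ℕ → List ℕ
  timesPoch zero    G = G
  timesPoch (suc k) G = plusTimesLinear 0 (suc k) (timesPoch k G)

  length-timesPoch : ∀ k G → length (timesPoch k G) ≡ k + length G
  length-timesPoch zero    G = refl
  length-timesPoch (suc k) G = trans (length-plusTimesLinear 0 (suc k) (timesPoch k G)) (cong suc (length-timesPoch k G))

  monicAt-timesPoch : ∀ k G x → monicAt (timesPoch k G) x ≡ poch (suc x) k * monicAt G x
  monicAt-timesPoch zero    G x = sym (+-identityʳ _)
  monicAt-timesPoch (suc k) G x =
    trans (monicAt-plusTimesLinear 0 (suc k) (timesPoch k G) x)
          (trans (cong ((x + suc k) *_) (monicAt-timesPoch k G x)) (step x k (poch (suc x) k) (monicAt G x)))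
    where step : ∀ x k P M → (x + suc k) * (P * M) ≡ P * (suc x + k) * M
          step = solve-∀

  xDerivAt-timesPoch : ∀ k G x →
    xDerivAt (timesPoch k G) x ≡ x * poch′ (suc x) k * monicAt G x + poch (suc x) k * xDerivAt G x
  xDerivAt-timesPoch zero    G x = step x (monicAt G x) (xDerivAt G x)
    where step : ∀ x M D → D ≡ x * 0 * M + 1 * D
          step = solve-∀
  xDerivAt-timesPoch (suc k) G x =
    begin
      xDerivAt (plusTimesLinear 0 (suc k) (timesPoch k G)) x
    ≡⟨ xDerivAt-plusTimesLinear 0 (suc k) (timesPoch k G) x ⟩
      x * monicAt (timesPoch k G) x + (x + suc k) * xDerivAt (timesPoch k G) x
    ≡⟨ cong₂ (λ u v → x * u + (x + suc k) * v) (monicAt-timesPoch k G x) (xDerivAt-timesPoch k G x) ⟩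
      x * (P * M) + (x + suc k) * (x * P′ * M + P * D)
    ≡⟨ step x k P P′ M D ⟩
      x * (P′ * (suc x + k) + P) * M + P * (suc x + k) * D
    ∎
    where
      P = poch (suc x) k
      P′ = poch′ (suc x) k
      M = monicAt G x
      D = xDerivAt G x
      step : ∀ x k P P′ M D → x * (P * M) + (x + suc k) * (x * P′ * M + P * D)
                              ≡ x * (P′ * (suc x + k) + P) * M + P * (suc x + k) * D
      step = solve-∀

  pochProduct : (n : ℕ) → (Fin.Fin n → ℕ) → List ℕ
  pochProduct zero    a = []
  pochProduct (suc n) a = timesPoch (a Fin.zero) (pochProduct n (λ i → a (Fin.suc i)))

  pochProductAt : ℕ → (n : ℕ) → (Fin.Fin n → ℕ) → ℕ
  pochProductAt j n a = prodFinℕ n (λ i → poch (suc j) (a i))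

  pochProductAt′ : ℕ → (n : ℕ) → (Fin.Fin n → ℕ) → ℕ
  pochProductAt′ j zero    a = 0
  pochProductAt′ j (suc n) a =
    poch′ (suc j) (a Fin.zero) * pochProductAt j n (λ i → a (Fin.suc i))
    + poch (suc j) (a Fin.zero) * pochProductAt′ j n (λ i → a (Fin.suc i))

  length-pochProduct : ∀ n a → length (pochProduct n a) ≡ sumFinℕ n a
  length-pochProduct zero    a = refl
  length-pochProduct (suc n) a = trans (length-timesPoch (a Fin.zero) _) (cong (a Fin.zero +_) (length-pochProduct n _))

  monicAt-pochProduct : ∀ n a j → monicAt (pochProduct n a) j ≡ pochProductAt j n a
  monicAt-pochProduct zero    a j = refl
  monicAt-pochProduct (suc n) a j =
    trans (monicAt-timesPoch (a Fin.zero) _ j) (cong (poch (suc j) (a Fin.zero) *_) (monicAt-pochProduct n _ j))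

  xDerivAt-pochProduct : ∀ n a j → xDerivAt (pochProduct n a) j ≡ j * pochProductAt′ j n a
  xDerivAt-pochProduct zero    a j = sym (*-zeroʳ j)
  xDerivAt-pochProduct (suc n) a j =
    begin
      xDerivAt (timesPoch (a Fin.zero) (pochProduct n a⁺)) j
    ≡⟨ xDerivAt-timesPoch (a Fin.zero) _ j ⟩
      j * d * monicAt (pochProduct n a⁺) j + c * xDerivAt (pochProduct n a⁺) j
    ≡⟨ cong₂ (λ u v → j * d * u + c * v) (monicAt-pochProduct n a⁺ j) (xDerivAt-pochProduct n a⁺ j) ⟩
      j * d * pochProductAt j n a⁺ + c * (j * pochProductAt′ j n a⁺)
    ≡⟨ factor j d (pochProductAt j n a⁺) c (pochProductAt′ j n a⁺) ⟩
      j * pochProductAt′ j (suc n) a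
    ∎
    where
      a⁺ : Fin.Fin n → ℕ
      a⁺ i = a (Fin.suc i)
      c = poch (suc j) (a Fin.zero)
      d = poch′ (suc j) (a Fin.zero)
      factor : ∀ j d P c P′ → j * d * P + c * (j * P′) ≡ j * (d * P + c * P′)
      factor = solve-∀

module BinomialPolynomials where
  open import Data.Nat
  open import Data.Nat.Properties
  open import Data.Nat.Combinatorics using (_C_; nCn≡1; nC1≡n; nCk≡nC[n∸k]; nCk+nC[k+1]≡[n+1]C[k+1]; k>n⇒nCk≡0)
  open import Data.Nat.Tactic.RingSolver using (solve-∀)
  open import Data.List using (List; []; _∷_; length; _++_)
  open import Relation.Binary.PropositionalEquality
  open ≡-Reasoning
  open MonicPolynomials

  nC0≡1 : ∀ n → n C 0 ≡ 1
  nC0≡1 n = trans (nCk≡nC[n∸k] {0} {n} z≤n) (nCn≡1 n)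

  [n+1]Cn≡n+1 : ∀ n → suc n C n ≡ suc n
  [n+1]Cn≡n+1 n = trans (nCk≡nC[n∸k] {n} {suc n} (n≤1+n n)) (trans (cong (suc n C_) (m+n∸n≡m 1 n)) (nC1≡n (suc n)))

  absorption : ∀ n k → suc k * (suc n C suc k) ≡ suc n * (n C k)
  absorption n zero =
    trans (*-identityˡ _) (trans (nC1≡n (suc n)) (trans (sym (*-identityʳ (suc n))) (cong (suc n *_) (sym (nC0≡1 n)))))
  absorption zero (suc k) =
    trans (cong (suc (suc k) *_) (k>n⇒nCk≡0 {1} {suc (suc k)} (s≤s (s≤s z≤n)))) (trans (*-zeroʳ (suc (suc k)))
          (sym (cong (1 *_) (k>n⇒nCk≡0 {0} {suc k} (s≤s z≤n)))))
  absorption (suc n) (suc k) =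
    begin
      suc (suc k) * (suc (suc n) C suc (suc k))
    ≡⟨ cong (suc (suc k) *_) (sym (nCk+nC[k+1]≡[n+1]C[k+1] (suc n) (suc k))) ⟩
      suc (suc k) * (suc n C suc k + suc n C suc (suc k))
    ≡⟨ split k (suc n C suc k) (suc n C suc (suc k)) ⟩
      suc k * (suc n C suc k) + suc n C suc k + suc (suc k) * (suc n C suc (suc k))
    ≡⟨ cong₃ (absorption n k) (sym (nCk+nC[k+1]≡[n+1]C[k+1] n k)) (absorption n (suc k)) ⟩
      suc n * (n C k) + (n C k + n C suc k) + suc n * (n C suc k)
    ≡⟨ merge n (n C k) (n C suc k) ⟩
      suc (suc n) * (n C k + n C suc k)
    ≡⟨ cong (suc (suc n) *_) (nCk+nC[k+1]≡[n+1]C[k+1] n k) ⟩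
      suc (suc n) * (suc n C suc k)
    ∎
    where
      cong₃ : ∀ {a a′ b b′ c c′ : ℕ} → a ≡ a′ → b ≡ b′ → c ≡ c′ → a + b + c ≡ a′ + b′ + c′
      cong₃ refl refl refl = refl
      split : ∀ k a b → suc (suc k) * (a + b) ≡ suc k * a + a + suc (suc k) * b
      split = solve-∀
      merge : ∀ n a b → suc n * a + (a + b) + suc n * b ≡ suc (suc n) * (a + b)
      merge = solve-∀

  binomialRow : ℕ → ℕ → ℕ → List ℕ
  binomialRow m i zero    = []
  binomialRow m i (suc n) = m C i ∷ binomialRow m (suc i) n

  length-binomialRow : ∀ m i n → length (binomialRow m i n) ≡ n
  length-binomialRow m i zero    = refl
  length-binomialRow m i (suc n) = cong suc (length-binomialRow m (suc i) n)

  binomialRow-snoc : ∀ m i n → binomialRow m i (suc n) ≡ binomialRow m i n ++ (m C (i + n) ∷ [])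
  binomialRow-snoc m i zero    = cong (λ k → m C k ∷ []) (sym (+-identityʳ i))
  binomialRow-snoc m i (suc n) = cong (m C i ∷_) (trans (binomialRow-snoc m (suc i) n) (cong (λ k → binomialRow m (suc i) n ++ (m C k ∷ [])) (sym (+-suc i n))))

  plusTimesLinear-binomialRow : ∀ c m i n → i + n ≡ m →
    plusTimesLinear c 1 (binomialRow m i n) ≡ c + m C i ∷ binomialRow (suc m) (suc i) n
  plusTimesLinear-binomialRow c m i zero    i+0≡m =
    cong (λ v → c + v ∷ []) (sym (trans (cong (m C_) (trans (sym (+-identityʳ i)) i+0≡m)) (nCn≡1 m)))
  plusTimesLinear-binomialRow c m i (suc n) i+1+n≡m =
    cong₂ _∷_ (cong (c +_) (*-identityˡ (m C i)))
      (trans (plusTimesLinear-binomialRow (m C i) m (suc i) n (trans (sym (+-suc i n)) i+1+n≡m))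
             (cong (_∷ binomialRow (suc m) (suc (suc i)) n) (nCk+nC[k+1]≡[n+1]C[k+1] m i)))

  binomial : ℕ → List ℕ
  binomial m = binomialRow m 0 m

  monicAt-binomial : ∀ m x → monicAt (binomial m) x ≡ suc x ^ m
  monicAt-binomial zero    x = refl
  monicAt-binomial (suc m) x =
    begin
      monicAt (suc m C 0 ∷ binomialRow (suc m) 1 m) x
    ≡⟨ cong (λ v → monicAt (v ∷ binomialRow (suc m) 1 m) x) (trans (nC0≡1 (suc m)) (sym (nC0≡1 m))) ⟩
      monicAt (0 + m C 0 ∷ binomialRow (suc m) 1 m) x
    ≡⟨ cong (λ G → monicAt G x) (sym (plusTimesLinear-binomialRow 0 m 0 m refl)) ⟩
      monicAt (plusTimesLinear 0 1 (binomial m)) x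
    ≡⟨ monicAt-plusTimesLinear 0 1 (binomial m) x ⟩
      (x + 1) * monicAt (binomial m) x
    ≡⟨ cong₂ _*_ (+-comm x 1) (monicAt-binomial m x) ⟩
      suc x ^ suc m
    ∎

  binomialTheorem : ∀ m x → suc x ^ m ≡ lowerAt (binomial m) x + x ^ m
  binomialTheorem m x =
    trans (sym (monicAt-binomial m x))
          (trans (monicAt-lowerAt (binomial m) x) (cong (λ d → lowerAt (binomial m) x + x ^ d) (length-binomialRow m 0 m)))

module PowerSums (p : ℕ) where
  open import Data.Nat
  open import Data.Nat.Properties
  open import Data.Nat.Divisibility using (_∣_; _∣0; ∣m∣n⇒∣m+n; ∣n⇒∣m*n)
  open import Data.Nat.Tactic.RingSolver using (solve-∀)
  open import Data.List using (List; []; _∷_; length; _++_)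
  open import Relation.Binary.PropositionalEquality
  open ≡-Reasoning
  open NatArithmetic
  open MonicPolynomials
  open BinomialPolynomials

  powerSum : ℕ → ℕ
  powerSum m = Σ< p (λ j → j ^ m)

  -- Σ_{j<p} (x^{m+1})′(j) = (m + 1)·powerSum m.
  derivSum : ℕ → ℕ
  derivSum m = suc m * powerSum m

  weigh : (ℕ → ℕ) → ℕ → List ℕ → ℕ
  weigh w m []      = 0
  weigh w m (g ∷ G) = g * w m + weigh w (suc m) G

  weigh-snoc : ∀ w m G c → weigh w m (G ++ (c ∷ [])) ≡ weigh w m G + c * w (m + length G)
  weigh-snoc w m []      c = trans (+-identityʳ _) (cong (λ k → c * w k) (sym (+-identityʳ m)))
  weigh-snoc w m (g ∷ G) c =
    trans (cong (g * w m +_) (weigh-snoc w (suc m) G c))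
          (trans (sym (+-assoc (g * w m) _ _)) (cong (λ k → g * w m + weigh w (suc m) G + c * w k) (sym (+-suc m (length G)))))

  weigh-∣ : ∀ {d} w m G → (∀ i → i < m + length G → d ∣ w i) → d ∣ weigh w m G
  weigh-∣ {d} w m []      d∣w = d ∣0
  weigh-∣ {d} w m (g ∷ G) d∣w =
    ∣m∣n⇒∣m+n (∣n⇒∣m*n g (d∣w m (subst (m <_) (sym (+-suc m (length G))) (s≤s (m≤m+n m (length G))))))
              (weigh-∣ w (suc m) G (λ i i<1+m+|G| → d∣w i (subst (i <_) (sym (+-suc m (length G))) i<1+m+|G|)))

  Σ-lowerAt : ∀ m G → Σ< p (λ j → j ^ m * lowerAt G j) ≡ weigh powerSum m G
  Σ-lowerAt m [] = trans (Σ<-cong p (λ j → *-zeroʳ (j ^ m))) (Σ<-* p 0 (λ _ → 0))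
  Σ-lowerAt m (g ∷ G) =
    begin
      Σ< p (λ j → j ^ m * (g + j * lowerAt G j))
    ≡⟨ Σ<-cong p (λ j → expand g j (j ^ m) (lowerAt G j)) ⟩
      Σ< p (λ j → g * j ^ m + j ^ suc m * lowerAt G j)
    ≡⟨ Σ<-+ p _ _ ⟩
      Σ< p (λ j → g * j ^ m) + Σ< p (λ j → j ^ suc m * lowerAt G j)
    ≡⟨ cong₂ _+_ (Σ<-* p g (λ j → j ^ m)) (Σ-lowerAt (suc m) G) ⟩
      g * powerSum m + weigh powerSum (suc m) G
    ∎
    where expand : ∀ g j J L → J * (g + j * L) ≡ g * J + j * J * L
          expand = solve-∀

  -- Summing (x^{m+1}·M_G)′ = x^m·((m + 1)·M_G + x·M_G′) over j < p.
  Σ-xDeriv : ∀ m G → Σ< p (λ j → j ^ m * (suc m * monicAt G j + xDerivAt G j))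
                     ≡ weigh derivSum m G + derivSum (m + length G)
  Σ-xDeriv m [] =
    begin
      Σ< p (λ j → j ^ m * (suc m * 1 + 0))
    ≡⟨ Σ<-cong p (λ j → leading m (j ^ m)) ⟩
      Σ< p (λ j → suc m * j ^ m)
    ≡⟨ Σ<-* p (suc m) (λ j → j ^ m) ⟩
      derivSum m
    ≡⟨ cong derivSum (sym (+-identityʳ m)) ⟩
      derivSum (m + 0)
    ∎
    where leading : ∀ m J → J * (suc m * 1 + 0) ≡ suc m * J
          leading = solve-∀
  Σ-xDeriv m (g ∷ G) =
    begin
      Σ< p (λ j → j ^ m * (suc m * (g + j * monicAt G j) + j * (monicAt G j + xDerivAt G j)))
    ≡⟨ Σ<-cong p (λ j → expand m g j (j ^ m) (monicAt G j) (xDerivAt G j)) ⟩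
      Σ< p (λ j → suc m * g * j ^ m + j ^ suc m * (suc (suc m) * monicAt G j + xDerivAt G j))
    ≡⟨ Σ<-+ p _ _ ⟩
      Σ< p (λ j → suc m * g * j ^ m) + Σ< p (λ j → j ^ suc m * (suc (suc m) * monicAt G j + xDerivAt G j))
    ≡⟨ cong₂ _+_ (trans (Σ<-* p (suc m * g) (λ j → j ^ m)) (regroup m g (powerSum m))) (Σ-xDeriv (suc m) G) ⟩
      g * derivSum m + (weigh derivSum (suc m) G + derivSum (suc m + length G))
    ≡⟨ sym (+-assoc (g * derivSum m) _ _) ⟩
      weigh derivSum m (g ∷ G) + derivSum (suc m + length G)
    ≡⟨ cong (λ k → weigh derivSum m (g ∷ G) + derivSum k) (sym (+-suc m (length G))) ⟩
      weigh derivSum m (g ∷ G) + derivSum (m + length (g ∷ G))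
    ∎
    where
      expand : ∀ m g j J M D → J * (suc m * (g + j * M) + j * (M + D))
                               ≡ suc m * g * J + j * J * (suc (suc m) * M + D)
      expand = solve-∀
      regroup : ∀ m g S → suc m * g * S ≡ g * (suc m * S)
      regroup = solve-∀

  -- Telescoping Σ_{j<p} ((j + 1)^{k+1} - j^{k+1}) = p^{k+1}.
  Σ-binomial : ∀ k → Σ< p (λ j → lowerAt (binomial (suc k)) j) ≡ p ^ suc k
  Σ-binomial k = +-cancelʳ-≡ _ _ _
    (begin
      Σ< p (λ j → lowerAt (binomial (suc k)) j) + powerSum (suc k)
    ≡⟨ sym (Σ<-+ p _ _) ⟩
      Σ< p (λ j → lowerAt (binomial (suc k)) j + j ^ suc k)
    ≡⟨ Σ<-cong p (λ j → sym (binomialTheorem (suc k) j)) ⟩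
      Σ< p (λ j → suc j ^ suc k)
    ≡⟨ sym (Σ<-first p (λ j → j ^ suc k)) ⟩
      powerSum (suc k) + p ^ suc k
    ≡⟨ +-comm (powerSum (suc k)) (p ^ suc k) ⟩
      p ^ suc k + powerSum (suc k)
    ∎)

-- Power sums modulo the prime p = r + 2 (so p - 1 = q = r + 1), up to exponent 2(p - 1).
module PrimePowerSums (r : ℕ) (isPrime : Prime (suc (suc r))) where
  open import Data.Nat
  open import Data.Nat.Properties
  open import Data.Nat.Divisibility
  open import Data.Nat.Combinatorics using (_C_)
  open import Data.Nat.Tactic.RingSolver using (solve-∀)
  open import Data.List using (_∷_; []; _++_; length)
  open import Data.List.Relation.Unary.All using (All; []; _∷_)
  open import Data.Sum using (inj₁; inj₂)
  open import Relation.Nullary using (¬_)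
  open import Relation.Binary.Definitions using (tri<; tri≈; tri>)
  open import Relation.Binary.PropositionalEquality
  open ≡-Reasoning
  open NatArithmetic
  open MonicPolynomials
  open BinomialPolynomials

  p q : ℕ
  p = suc (suc r)
  q = suc r

  open PowerSums p

  p∤ : ∀ {k} → 0 < k → k < p → ¬ p ∣ k
  p∤ {suc k} _ k<p p∣k = <⇒≱ k<p (∣⇒≤ p∣k)

  lowerAt-∣ : ∀ {d} G x → All (d ∣_) G → d ∣ lowerAt G x
  lowerAt-∣ []      x []          = _ ∣0
  lowerAt-∣ (g ∷ G) x (d∣g ∷ d∣G) = ∣m∣n⇒∣m+n d∣g (∣n⇒∣m*n x (lowerAt-∣ G x d∣G))

  binomial-∣ : ∀ i → 0 < i → i < p → p ∣ p C i
  binomial-∣ (suc k) 0<i i<p =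
    prime-cancelˡ isPrime (p∤ 0<i i<p) (subst (p ∣_) (sym (absorption q k)) (m∣m*n (q C k)))

  binomialRow-∣ : ∀ i n → 0 < i → i + n ≤ p → All (p ∣_) (binomialRow p i n)
  binomialRow-∣ i zero    0<i i≤p   = []
  binomialRow-∣ i (suc n) 0<i i+1+n≤p =
    binomial-∣ i 0<i (<-≤-trans (m<m+n i (s≤s z≤n)) i+1+n≤p)
    ∷ binomialRow-∣ (suc i) n (s≤s z≤n) (subst (_≤ p) (+-suc i n) i+1+n≤p)

  freshmansDream : ∀ x → suc x ^ p ≡⁺ x ^ p + 1 [mod p ]
  freshmansDream x with lowerAt-∣ (binomialRow p 1 q) x (binomialRow-∣ 1 q (s≤s z≤n) ≤-refl)
  ... | divides t inner≡tp = congruent (x * t)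
    (begin
      suc x ^ p
    ≡⟨ binomialTheorem p x ⟩
      p C 0 + x * lowerAt (binomialRow p 1 q) x + x ^ p
    ≡⟨ cong₂ (λ c v → c + x * v + x ^ p) (nC0≡1 p) inner≡tp ⟩
      1 + x * (t * p) + x ^ p
    ≡⟨ regroup x t p (x ^ p) ⟩
      x ^ p + 1 + p * (x * t)
    ∎)
    where regroup : ∀ x t p X → 1 + x * (t * p) + X ≡ X + 1 + p * (x * t)
          regroup = solve-∀

  fermat : ∀ x → x ^ p ≡⁺ x [mod p ]
  fermat zero    = ≡⁺-reflexive refl
  fermat (suc x) = ≡⁺-trans (freshmansDream x) (≡⁺-trans (≡⁺-+ (fermat x) (≡⁺-reflexive refl)) (≡⁺-reflexive (+-comm x 1)))

  -- For p ∤ j the factor j cancels: j^{p-1} ≡ 1.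
  fermat′ : ∀ j → 0 < j → j < p → j ^ q ≡⁺ 1 [mod p ]
  fermat′ j 0<j j<p = ≡⁺-cancelˡ isPrime (p∤ 0<j j<p) (≡⁺-trans (fermat j) (≡⁺-reflexive (sym (*-identityʳ j))))

  -- p ∣ powerSum k for k < p - 1, by strong induction: expanding Σ_{j<p}((j+1)^{k+1} - j^{k+1}) = p^{k+1}
  -- gives (k + 1)·powerSum k plus a combination of lower power sums.
  powerSum-step : ∀ k → k < q → (∀ i → i < k → p ∣ powerSum i) → p ∣ powerSum k
  powerSum-step k k<q lower = prime-cancelˡ isPrime (p∤ (s≤s z≤n) (s≤s k<q)) p∣[k+1]S
    where
      S-expansion : p ^ suc k ≡ weigh powerSum 0 (binomialRow (suc k) 0 k) + suc k * powerSum k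
      S-expansion =
        begin
          p ^ suc k
        ≡⟨ sym (Σ-binomial k) ⟩
          Σ< p (λ j → lowerAt (binomial (suc k)) j)
        ≡⟨ Σ<-cong p (λ j → sym (*-identityˡ _)) ⟩
          Σ< p (λ j → j ^ 0 * lowerAt (binomial (suc k)) j)
        ≡⟨ Σ-lowerAt 0 (binomial (suc k)) ⟩
          weigh powerSum 0 (binomialRow (suc k) 0 (suc k))
        ≡⟨ cong (weigh powerSum 0) (binomialRow-snoc (suc k) 0 k) ⟩
          weigh powerSum 0 (binomialRow (suc k) 0 k ++ (suc k C k ∷ []))
        ≡⟨ weigh-snoc powerSum 0 (binomialRow (suc k) 0 k) (suc k C k) ⟩
          weigh powerSum 0 (binomialRow (suc k) 0 k) + (suc k C k) * powerSum (length (binomialRow (suc k) 0 k))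
        ≡⟨ cong₂ (λ c i → weigh powerSum 0 (binomialRow (suc k) 0 k) + c * powerSum i)
                 ([n+1]Cn≡n+1 k) (length-binomialRow (suc k) 0 k) ⟩
          weigh powerSum 0 (binomialRow (suc k) 0 k) + suc k * powerSum k
        ∎
      p∣lower : p ∣ weigh powerSum 0 (binomialRow (suc k) 0 k)
      p∣lower = weigh-∣ powerSum 0 (binomialRow (suc k) 0 k) (λ i i<k → lower i (subst (i <_) (length-binomialRow (suc k) 0 k) i<k))
      p∣[k+1]S : p ∣ suc k * powerSum k
      p∣[k+1]S = ∣m+n∣m⇒∣n (subst (p ∣_) S-expansion (m∣m*n (p ^ k))) p∣lower

  powerSum-low : ∀ k → k ≤ q → ∀ i → i < k → p ∣ powerSum i
  powerSum-low (suc k) k<q i i<1+k with m≤n⇒m<n∨m≡n (≤-pred i<1+k)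
  ... | inj₁ i<k  = powerSum-low k (≤-trans (n≤1+n k) k<q) i i<k
  ... | inj₂ refl = powerSum-step k k<q (powerSum-low k (≤-trans (n≤1+n k) k<q))

  -- powerSum q ≡ q (mod p), since j^q ≡ 1 for 0 < j < p.
  powerSum-q : powerSum q ≡⁺ q [mod p ]
  powerSum-q = ≡⁺-trans (≡⁺-reflexive (Σ<-first q (λ j → j ^ q)))
                        (≡⁺-trans (Σ<-≡⁺ q (λ j j<q → fermat′ (suc j) (s≤s z≤n) (s≤s j<q))) (≡⁺-reflexive (Σ<-ones q)))

  -- Exponents may be shifted by p - 1, as long as they stay positive.
  powerSum-shift : ∀ k → 0 < k → powerSum (k + q) ≡⁺ powerSum k [mod p ]
  powerSum-shift (suc k) _ = Σ<-≡⁺ p shift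
    where
      shift : ∀ j → j < p → j ^ (suc k + q) ≡⁺ j ^ suc k [mod p ]
      shift zero    _   = ≡⁺-reflexive refl
      shift (suc j) j<p =
        ≡⁺-trans (≡⁺-reflexive (^-distribˡ-+-* (suc j) (suc k) q))
                 (≡⁺-trans (≡⁺-*ˡ (suc j ^ suc k) (fermat′ (suc j) (s≤s z≤n) j<p)) (≡⁺-reflexive (*-identityʳ _)))

  derivSum-∣ : ∀ i → i < 2 * q → p ∣ derivSum i
  derivSum-∣ i i<2q with <-cmp i q
  ... | tri< i<q _ _ = ∣n⇒∣m*n (suc i) (powerSum-low q ≤-refl i i<q)
  ... | tri≈ _ refl _ = m∣m*n (powerSum q)
  ... | tri> _ _ q<i = ∣n⇒∣m*n (suc i) (subst (λ e → p ∣ powerSum e) k+q≡i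
          (≡⁺-∣ (powerSum-shift k (m<n⇒0<n∸m q<i)) (powerSum-low q ≤-refl k k<q)))
    where
      k = i ∸ q
      k+q≡i : k + q ≡ i
      k+q≡i = m∸n+n≡m (<⇒≤ q<i)
      k<q : k < q
      k<q = +-cancelʳ-< q k q (subst (_< q + q) (sym k+q≡i) (subst (i <_) (cong (q +_) (+-identityʳ q)) i<2q))

  -- (2q + 1)·powerSum (2q) ≡ (2q + 1)·q = 1 + p·(2q - 1), i.e. (-1)·(-1) = 1 modulo p.
  derivSum-2q : derivSum (2 * q) ≡⁺ 1 [mod p ]
  derivSum-2q =
    ≡⁺-trans (≡⁺-*ˡ (suc (2 * q)) powerSum-2q≡q) (congruent (2 * r + 1) (odd r))
    where
      powerSum-2q≡q : powerSum (2 * q) ≡⁺ q [mod p ]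
      powerSum-2q≡q = ≡⁺-trans (≡⁺-reflexive (cong powerSum (cong (q +_) (+-identityʳ q))))
                               (≡⁺-trans (powerSum-shift q (s≤s z≤n)) powerSum-q)
      odd : ∀ r → suc (2 * suc r) * suc r ≡ 1 + suc (suc r) * (2 * r + 1)
      odd = solve-∀

module HarmonicBridge where
  open import Data.Nat as ℕ using (ℕ; zero; suc)
  import Data.Nat.Properties as ℕP
  open import Data.Nat.Divisibility using (∣⇒≤)
  open import Data.Nat.Coprimality using (1-coprimeTo) renaming (sym to coprime-sym)
  open import Data.Integer as ℤ using (+_)
  import Data.Integer.Properties as ℤP
  open import Data.Rational
  open import Data.Rational.Properties
  import Data.Rational.Unnormalised as ℚᵘ
  import Data.Rational.Unnormalised.Properties as ℚᵘP
  open import Data.Fin as Fin using (Fin)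
  open import Relation.Nullary.Decidable using (dec⇒maybe)
  open import Data.Product using (_,_)
  open import Level using (0ℓ)
  open import Relation.Binary.PropositionalEquality
  open import Tactic.RingSolver using (solve-∀)
  import Tactic.RingSolver.Core.AlmostCommutativeRing as ACR
  open import Defs using (ι; H; poch; sumFin; sumTo; S; _≡_[modℚ_])
  open NatArithmetic using (Σ<; _≡⁺_[mod_]; congruent)
  open MonicPolynomials using (poch′; pochProductAt; pochProductAt′)

  ℚ-ring : ACR.AlmostCommutativeRing 0ℓ 0ℓ
  ℚ-ring = ACR.fromCommutativeRing +-*-commutativeRing (λ x → dec⇒maybe (0ℚ ≟ x))

  toℚᵘ-ι : ∀ n → toℚᵘ (ι n) ≡ ℚᵘ.mkℚᵘ (+ n) 0
  toℚᵘ-ι n = cong toℚᵘ (normalize-coprime {n} {0} (coprime-sym (1-coprimeTo n)))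

  ι-+ : ∀ m n → ι (m ℕ.+ n) ≡ ι m + ι n
  ι-+ m n = toℚᵘ-injective (ℚᵘP.≃-trans (ℚᵘP.≃-reflexive (toℚᵘ-ι (m ℕ.+ n)))
     (ℚᵘP.≃-trans (ℚᵘ.*≡* cross) (ℚᵘP.≃-sym (ℚᵘP.≃-trans (toℚᵘ-homo-+ (ι m) (ι n))
                                            (ℚᵘP.≃-reflexive (cong₂ ℚᵘ._+_ (toℚᵘ-ι m) (toℚᵘ-ι n)))))))
    where
      cross : + (m ℕ.+ n) ℤ.* + 1 ≡ (+ m ℤ.* + 1 ℤ.+ + n ℤ.* + 1) ℤ.* + 1
      cross = trans (ℤP.*-identityʳ _) (trans (ℤP.pos-+ m n)
                (sym (trans (ℤP.*-identityʳ _) (cong₂ ℤ._+_ (ℤP.*-identityʳ (+ m)) (ℤP.*-identityʳ (+ n))))))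

  ι-* : ∀ m n → ι (m ℕ.* n) ≡ ι m * ι n
  ι-* m n = toℚᵘ-injective (ℚᵘP.≃-trans (ℚᵘP.≃-reflexive (toℚᵘ-ι (m ℕ.* n)))
     (ℚᵘP.≃-trans (ℚᵘ.*≡* (cong (ℤ._* + 1) (ℤP.pos-* m n)))
                  (ℚᵘP.≃-sym (ℚᵘP.≃-trans (toℚᵘ-homo-* (ι m) (ι n))
                                          (ℚᵘP.≃-reflexive (cong₂ ℚᵘ._*_ (toℚᵘ-ι m) (toℚᵘ-ι n)))))))

  ι-inverse : ∀ n → ι (suc n) * ((+ 1) / suc n) ≡ 1ℚ
  ι-inverse n = toℚᵘ-injective (ℚᵘP.≃-trans (toℚᵘ-homo-* (ι (suc n)) ((+ 1) / suc n))
     (ℚᵘP.≃-trans (ℚᵘP.≃-reflexive (cong₂ ℚᵘ._*_ (toℚᵘ-ι (suc n)) (cong toℚᵘ (normalize-coprime {1} {n} (1-coprimeTo (suc n))))))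
                  (ℚᵘ.*≡* cross)))
    where
      cross : + (suc n) ℤ.* + 1 ℤ.* + 1 ≡ + 1 ℤ.* + (1 ℕ.* suc n)
      cross = trans (ℤP.*-identityʳ _) (trans (ℤP.*-identityʳ _)
                (sym (trans (ℤP.*-identityˡ _) (cong +_ (ℕP.*-identityˡ (suc n))))))

  -- Logarithmic derivative of the rising factorial:
  -- (j+1)_k·(H_{k+j} - H_j) = (j+1)_k·Σ_{t=1}^{k} 1/(j+t) = d/dx (x)_k at x = j + 1.
  poch-logDerivative : ∀ j k → ι (poch (suc j) k) * (H (k ℕ.+ j) - H j) ≡ ι (poch′ (suc j) k)
  poch-logDerivative j zero = trans (cong (ι 1 *_) (+-inverseʳ (H j))) (*-zeroʳ (ι 1))
  poch-logDerivative j (suc k) =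
    begin
      ι (poch (suc j) k ℕ.* (suc j ℕ.+ k)) * ((H (k ℕ.+ j) + 1/[j+k+1]) - H j)
    ≡⟨ cong₂ _*_ (ι-* (poch (suc j) k) (suc j ℕ.+ k)) (reassociate (H (k ℕ.+ j)) 1/[j+k+1] (H j)) ⟩
      (P * c) * (Δ + 1/[j+k+1])
    ≡⟨ distribute P c Δ 1/[j+k+1] ⟩
      (P * Δ) * c + P * (c * 1/[j+k+1])
    ≡⟨ cong₂ (λ u v → u * c + P * v) (poch-logDerivative j k) c·inverse≡1 ⟩
      ι (poch′ (suc j) k) * c + P * 1ℚ
    ≡⟨ cong (λ v → ι (poch′ (suc j) k) * c + v) (*-identityʳ P) ⟩
      ι (poch′ (suc j) k) * c + P
    ≡⟨ cong (_+ P) (sym (ι-* (poch′ (suc j) k) (suc j ℕ.+ k))) ⟩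
      ι (poch′ (suc j) k ℕ.* (suc j ℕ.+ k)) + P
    ≡⟨ sym (ι-+ (poch′ (suc j) k ℕ.* (suc j ℕ.+ k)) (poch (suc j) k)) ⟩
      ι (poch′ (suc j) (suc k))
    ∎
    where
      open ≡-Reasoning
      P = ι (poch (suc j) k)
      c = ι (suc j ℕ.+ k)
      Δ = H (k ℕ.+ j) - H j
      1/[j+k+1] = (+ 1) / suc (k ℕ.+ j)
      reassociate : ∀ h i g → (h + i) - g ≡ (h - g) + i
      reassociate = solve-∀ ℚ-ring
      distribute : ∀ P c Δ i → (P * c) * (Δ + i) ≡ (P * Δ) * c + P * (c * i)
      distribute = solve-∀ ℚ-ring
      c·inverse≡1 : c * 1/[j+k+1] ≡ 1ℚ
      c·inverse≡1 = trans (cong (λ m → ι (suc m) * 1/[j+k+1]) (ℕP.+-comm j k)) (ι-inverse (k ℕ.+ j))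

  pochProduct-logDerivative : ∀ j n (a : Fin n → ℕ) →
    ι (pochProductAt j n a) * sumFin n (λ i → H (a i ℕ.+ j) - H j) ≡ ι (pochProductAt′ j n a)
  pochProduct-logDerivative j zero a = *-zeroʳ (ι 1)
  pochProduct-logDerivative j (suc n) a =
    begin
      ι (c₀ ℕ.* Pₙ) * (Δ₀ + Σ′)
    ≡⟨ cong (_* (Δ₀ + Σ′)) (ι-* c₀ Pₙ) ⟩
      (ι c₀ * ι Pₙ) * (Δ₀ + Σ′)
    ≡⟨ distribute (ι c₀) (ι Pₙ) Δ₀ Σ′ ⟩
      (ι c₀ * Δ₀) * ι Pₙ + ι c₀ * (ι Pₙ * Σ′)
    ≡⟨ cong₂ (λ u v → u * ι Pₙ + ι c₀ * v) (poch-logDerivative j (a Fin.zero)) (pochProduct-logDerivative j n a⁺) ⟩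
      ι d₀ * ι Pₙ + ι c₀ * ι Pₙ′
    ≡⟨ sym (cong₂ _+_ (ι-* d₀ Pₙ) (ι-* c₀ Pₙ′)) ⟩
      ι (d₀ ℕ.* Pₙ) + ι (c₀ ℕ.* Pₙ′)
    ≡⟨ sym (ι-+ (d₀ ℕ.* Pₙ) (c₀ ℕ.* Pₙ′)) ⟩
      ι (pochProductAt′ j (suc n) a)
    ∎
    where
      open ≡-Reasoning
      a⁺ : Fin n → ℕ
      a⁺ i = a (Fin.suc i)
      c₀ = poch (suc j) (a Fin.zero)
      d₀ = poch′ (suc j) (a Fin.zero)
      Pₙ = pochProductAt j n a⁺
      Pₙ′ = pochProductAt′ j n a⁺
      Δ₀ = H (a Fin.zero ℕ.+ j) - H j
      Σ′ = sumFin n (λ i → H (a⁺ i ℕ.+ j) - H j)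
      distribute : ∀ x y d s → (x * y) * (d + s) ≡ (x * d) * y + x * (y * s)
      distribute = solve-∀ ℚ-ring

  S-summand : ∀ j n (a : Fin n → ℕ) →
    ι (pochProductAt j n a) * (1ℚ + ι j * sumFin n (λ i → H (a i ℕ.+ j) - H j))
      ≡ ι (pochProductAt j n a ℕ.+ j ℕ.* pochProductAt′ j n a)
  S-summand j n a =
    begin
      P * (1ℚ + ι j * Σ′)
    ≡⟨ distribute P (ι j) Σ′ ⟩
      P + ι j * (P * Σ′)
    ≡⟨ cong (λ v → P + ι j * v) (pochProduct-logDerivative j n a) ⟩
      P + ι j * ι (pochProductAt′ j n a)
    ≡⟨ cong (λ v → P + v) (sym (ι-* j (pochProductAt′ j n a))) ⟩
      P + ι (j ℕ.* pochProductAt′ j n a)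
    ≡⟨ sym (ι-+ (pochProductAt j n a) (j ℕ.* pochProductAt′ j n a)) ⟩
      ι (pochProductAt j n a ℕ.+ j ℕ.* pochProductAt′ j n a)
    ∎
    where
      open ≡-Reasoning
      P = ι (pochProductAt j n a)
      Σ′ = sumFin n (λ i → H (a i ℕ.+ j) - H j)
      distribute : ∀ P x s → P * (1ℚ + x * s) ≡ P + x * (P * s)
      distribute = solve-∀ ℚ-ring

  sumTo-ι : ∀ m f → sumTo m (λ j → ι (f j)) ≡ ι (Σ< m f)
  sumTo-ι zero    f = refl
  sumTo-ι (suc m) f = trans (cong (_+ ι (f m)) (sumTo-ι m f)) (sym (ι-+ (Σ< m f) (f m)))

  sumTo-cong : ∀ m {f g} → (∀ j → f j ≡ g j) → sumTo m f ≡ sumTo m g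
  sumTo-cong zero    f≡g = refl
  sumTo-cong (suc m) f≡g = cong₂ _+_ (sumTo-cong m f≡g) (f≡g m)

  S-natural : ∀ p n a → S p n a ≡ ι (Σ< p (λ j → pochProductAt j n a ℕ.+ j ℕ.* pochProductAt′ j n a))
  S-natural p n a = trans (sumTo-cong p (λ j → S-summand j n a)) (sumTo-ι p _)

  ≡⁺⇒≡[modℚ] : ∀ {p x y} → 1 ℕ.< p → x ≡⁺ y [mod p ] → ι x ≡ ι y [modℚ p ]
  ≡⁺⇒≡[modℚ] {p} {x} {y} 1<p (congruent s x≡y+ps) =
    + s , 1 , _ , (λ p∣1 → ℕP.<⇒≱ 1<p (∣⇒≤ p∣1)) ,
    (begin
      ι x - ι y
    ≡⟨ cong (λ z → ι z - ι y) x≡y+ps ⟩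
      ι (y ℕ.+ p ℕ.* s) - ι y
    ≡⟨ cong (_- ι y) (ι-+ y (p ℕ.* s)) ⟩
      (ι y + ι (p ℕ.* s)) - ι y
    ≡⟨ cancel (ι y) (ι (p ℕ.* s)) ⟩
      ι (p ℕ.* s)
    ≡⟨ cong (_/ 1) (ℤP.pos-* p s) ⟩
      ((+ p) ℤ.* (+ s)) / 1
    ∎)
    where
      open ≡-Reasoning
      cancel : ∀ u v → (u + v) - u ≡ v
      cancel = solve-∀ ℚ-ring

open import Defs
open import Data.Nat using (ℕ; _≤_; _<_; _*_; _∸_)
open import Data.Nat.Primality using (Prime)
open import Data.Nat.Divisibility using (_∣_)
open import Data.Fin using (Fin)
open import Data.Product using (_×_)
open import Data.Rational using (0ℚ; 1ℚ)
open import Relation.Nullary using (¬_)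
open import Relation.Binary.PropositionalEquality using (_≡_)

open import Data.Nat as ℕ using (zero; suc; _+_; _^_; z≤n; s≤s)
open import Data.Nat.Properties using (<-≤-trans; *-identityˡ)
open import Data.Nat.Primality using (prime⇒nonTrivial)
open import Data.Product using (_,_)
open import Relation.Binary.PropositionalEquality using (refl; sym; trans; cong; cong₂; subst)
open NatArithmetic
open MonicPolynomials
open HarmonicBridge

-- For p = r + 2 prime: Σ_{j<p} (x·F_a)′(j) ≡ derivSum (Σᵢ aᵢ) (mod p) once Σᵢ aᵢ ≤ 2(p - 1),
-- because every lower coefficient of F_a meets a derivSum divisible by p.
module ProductCongruence (r : ℕ) (isPrime : Prime (suc (suc r))) where
  open PrimePowerSums r isPrime using (p; q; derivSum-∣)
  open PowerSums p using (derivSum; weigh; weigh-∣; Σ-xDeriv)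

  Σ-xDeriv-pochProduct : ∀ n a → sumFinℕ n a ≤ 2 * q →
    Σ< p (λ j → pochProductAt j n a + j * pochProductAt′ j n a) ≡⁺ derivSum (sumFinℕ n a) [mod p ]
  Σ-xDeriv-pochProduct n a T≤2q = ≡⁺-trans (≡⁺-reflexive expansion) (≡⁺-+ (∣⇒≡⁺0 p∣lower) (≡⁺-reflexive refl))
    where
      F = pochProduct n a
      pointwise : ∀ j → pochProductAt j n a + j * pochProductAt′ j n a ≡ j ^ 0 * (1 * monicAt F j + xDerivAt F j)
      pointwise j = sym (trans (*-identityˡ _)
        (cong₂ _+_ (trans (*-identityˡ _) (monicAt-pochProduct n a j)) (xDerivAt-pochProduct n a j)))
      expansion : Σ< p (λ j → pochProductAt j n a + j * pochProductAt′ j n a)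
                  ≡ weigh derivSum 0 F + derivSum (sumFinℕ n a)
      expansion = trans (Σ<-cong p pointwise)
                        (trans (Σ-xDeriv 0 F) (cong (λ d → weigh derivSum 0 F + derivSum d) (length-pochProduct n a)))
      p∣lower : p ∣ weigh derivSum 0 F
      p∣lower = weigh-∣ derivSum 0 F (λ i i<|F| →
        derivSum-∣ i (<-≤-trans (subst (i <_) (length-pochProduct n a) i<|F|) T≤2q))

lemma3p15 : (p : ℕ) → Prime p → ¬ (2 ∣ p) →
    (n : ℕ) → (a : Fin n → ℕ) → (∀ i → 1 ≤ a i) →
    sumFinℕ n a ≤ 2 * (p ∸ 1) →
    ((sumFinℕ n a < 2 * (p ∸ 1) → S p n a ≡ 0ℚ [modℚ p ]) ×
    (sumFinℕ n a ≡ 2 * (p ∸ 1) → S p n a ≡ 1ℚ [modℚ p ]))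
lemma3p15 zero          isPrime _ n a _ _ with () ← ℕ.nonTrivial⇒n>1 0 {{prime⇒nonTrivial isPrime}}
lemma3p15 (suc zero)    isPrime _ n a _ _ with s≤s () ← ℕ.nonTrivial⇒n>1 1 {{prime⇒nonTrivial isPrime}}
lemma3p15 (suc (suc r)) isPrime _ n a _ T≤2q =
  (λ T<2q → inℚ (≡⁺-trans N≡derivSum (∣⇒≡⁺0 (derivSum-∣ T T<2q)))) ,
  (λ T≡2q → inℚ (≡⁺-trans N≡derivSum (subst (λ t → derivSum t ≡⁺ 1 [mod p ]) (sym T≡2q) derivSum-2q)))
  where
    open PrimePowerSums r isPrime using (p; derivSum-∣; derivSum-2q)
    open ProductCongruence r isPrime using (Σ-xDeriv-pochProduct)
    open PowerSums p using (derivSum)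
    T = sumFinℕ n a
    N = Σ< p (λ j → pochProductAt j n a + j * pochProductAt′ j n a)
    N≡derivSum : N ≡⁺ derivSum T [mod p ]
    N≡derivSum = Σ-xDeriv-pochProduct n a T≤2q
    inℚ : ∀ {y} → N ≡⁺ y [mod p ] → S p n a ≡ ι y [modℚ p ]
    inℚ {y} N≡y = subst (λ s → s ≡ ι y [modℚ p ]) (sym (S-natural p n a)) (≡⁺⇒≡[modℚ] (s≤s (s≤s z≤n)) N≡y)
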